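{- Let $p$ be an odd prime, $n\geq 2$, and $D=\{1\leq i\leq p^{n+1}-p-1:\ \gcd(i,p)=1\}$. Let $U$ be an irreducible solution of length $\ell$ and weight $w$ with $\ell=nw+r$, where $0\leq r<\frac{w}{2}$. If the support $\varphi_U$ has $w$ jumps, then $r=0$.
   Context: For $\ell\geq 1$, a solution of length $\ell$ is a tuple $U=(u_d)_{d\in D}$ with $0\leq u_d\leq p^\ell-1$, $\sum_{d\in D}du_d\equiv 0 \pmod{p^\ell-1}$ and $\sum_{d\in D}du_d>0$; its weight is $\sum_d s_p(u_d)$, with $s_p(n)$ the sum of base-$p$ digits of $n$. The shift is the map of $\{0,\dots,p^\ell-1\}$ fixing $p^\ell-1$ and sending other $j$ to $pj \bmod (p^\ell-1)$. The support of $U$ is $\varphi_U:\mathbb{Z}/\ell\mathbb{Z}\to\mathbb{Z}_{>0}$, $\varphi_U(k)=\frac{1}{p^\ell-1}\sum_d d\,\mathrm{shift}^k(u_d)$; $U$ is irreducible if $\varphi_U$ is injective. The number of jumps of $\varphi_U$ is the number of $i\in\mathbb{Z}/\ell\mathbb{Z}$ with $\varphi_U(i+1)\neq p\varphi_U(i)$ (for such $i$ one has $\varphi_U(i+1)<p\varphi_U(i)$). -}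

module Defs where

open import Data.Nat using (ℕ; zero; suc; _+_; _*_; _∸_; _^_; _≤_; _<_; _≟_)
open import Data.Nat.DivMod using (_/_; _%_)
open import Data.Nat.GCD using (gcd)
open import Data.Nat.Divisibility using (_∣_)
open import Data.List using (List; []; _∷_; map; filter; upTo; length)
open import Data.Nat.ListAction using (sum)
open import Data.Product using (_×_)
open import Data.List.Membership.Propositional using (_∈_)
open import Data.Fin using (Fin; toℕ)
open import Relation.Binary.PropositionalEquality using (_≡_)
open import Relation.Nullary using (¬_)
open import Relation.Nullary.Decidable using (¬?)

-- Division by a possibly-zero natural (only used with a nonzero divisor below).
_div_ : ℕ → ℕ → ℕ
m div zero    = 0
m div (suc k) = m / suc k

_mod_ : ℕ → ℕ → ℕ
m mod zero    = m
m mod (suc k) = m % suc k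

-- s_p(m): sum of base-p digits of m (for p ≥ 2; fuel m suffices).
digitSumAux : ℕ → ℕ → ℕ → ℕ
digitSumAux (suc (suc k)) (suc fuel) (suc m) =
  (suc m % suc (suc k)) + digitSumAux (suc (suc k)) fuel (suc m / suc (suc k))
digitSumAux _ _ _ = 0

digitSum : ℕ → ℕ → ℕ
digitSum p m = digitSumAux p m m

Dlist : ℕ → ℕ → List ℕ
Dlist p n = filter (λ i → gcd i p ≟ 1)
                   (map suc (upTo (p ^ (suc n) ∸ p ∸ 1)))

-- A tuple (u_d)_{d ∈ D} is represented by a function U : ℕ → ℕ; only its
-- values on D are ever used.

weightedSum : ℕ → ℕ → (ℕ → ℕ) → ℕ
weightedSum p n U = sum (map (λ d → d * U d) (Dlist p n))

IsSolution : (p n ℓ : ℕ) → (ℕ → ℕ) → Set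
IsSolution p n ℓ U =
  (∀ d → d ∈ Dlist p n → U d ≤ p ^ ℓ ∸ 1)
  × ((p ^ ℓ ∸ 1) ∣ weightedSum p n U)
  × (0 < weightedSum p n U)

weight : (p n : ℕ) → (ℕ → ℕ) → ℕ
weight p n U = sum (map (λ d → digitSum p (U d)) (Dlist p n))

shift : (p ℓ : ℕ) → ℕ → ℕ
shift p ℓ j with j ≟ p ^ ℓ ∸ 1
... | Relation.Nullary.yes _ = j
... | Relation.Nullary.no  _ = (p * j) mod (p ^ ℓ ∸ 1)

shiftIter : (p ℓ k : ℕ) → ℕ → ℕ
shiftIter p ℓ zero    j = j
shiftIter p ℓ (suc k) j = shift p ℓ (shiftIter p ℓ k j)

support : (p n ℓ : ℕ) → (ℕ → ℕ) → ℕ → ℕ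
support p n ℓ U k =
  weightedSum p n (λ d → shiftIter p ℓ k (U d)) div (p ^ ℓ ∸ 1)

Irreducible : (p n ℓ : ℕ) → (ℕ → ℕ) → Set
Irreducible p n ℓ U =
  ∀ (i j : Fin ℓ) → support p n ℓ U (toℕ i) ≡ support p n ℓ U (toℕ j) → i ≡ j

-- number of i ∈ ℤ/ℓℤ with φ(i+1) ≠ p φ(i); φ is ℓ-periodic (shift^ℓ = id),
-- so φ(ℓ) = φ(0) and i+1 need not be reduced mod ℓ.
jumps : (p n ℓ : ℕ) → (ℕ → ℕ) → ℕ
jumps p n ℓ U =
  length (filter (λ i → ¬? (support p n ℓ U (suc i) ≟ p * support p n ℓ U i))
                 (upTo ℓ))

module Submission where

-- Let t i d be the leading base-p digit of the i-th rotation shift^i (u_d) of u_d. Multiplying by p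
-- moves that digit to the end, so φ (i+1) + C i = p φ i with C i = Σ_d d t i d; and every digit of
-- u_d is leading exactly once per period, so the weight is Σ_{i<ℓ} T i with T i = Σ_d t i d.
-- A jump at i needs C i ≠ 0, hence T i ≥ 1; so there are at most w jumps, and w jumps force
-- T i ≤ 1, i.e. C i is 0 or a single element of D, whence C i + p ≤ p^(n+1).
-- Such an orbit stays below p^(n+1), and h i = ⌊log_p φ i⌋ grows by exactly one at each non-jump
-- while it drops by at most n − 1 at a jump: from φ i ≥ p^n one lands at p φ i − C i ≥ p.
-- As h is ℓ-periodic, ℓ − w ≤ (n − 1) w, i.e. ℓ ≤ n w and r = 0.

open import Defs
open import Data.Nat using (ℕ; _+_; _*_; _≤_; _<_)
open import Data.Nat.Primality using (Prime)
open import Relation.Binary.PropositionalEquality using (_≡_; _≢_)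

open import Data.Nat using (zero; suc; _∸_; _^_; _≟_; _≤?_; _<?_; z≤n; s≤s; z<s; s<s; s<s⁻¹; NonZero; >-nonZero)
open import Data.Nat.Properties
open import Data.Nat.DivMod hiding (_div_; _mod_)
open import Data.Nat.Divisibility using (_∣_; ∣m+n∣m⇒∣n; m∣m*n; ∣n⇒∣m*n)
open import Data.Nat.GCD using (gcd)
open import Data.Nat.Primality using (¬prime[0]; ¬prime[1])
open import Data.Nat.Tactic.RingSolver using (solve-∀)
open import Data.List using (List; []; _∷_; map; filter; applyUpTo; upTo; length)
open import Data.List.Properties using (map-cong-local)
open import Data.List.Relation.Unary.All using (tabulate)
open import Data.List.Membership.Propositional using (_∈_)
open import Data.List.Membership.Propositional.Properties using (∈-filter⁻; ∈-map⁻; ∈-upTo⁻)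
open import Data.List.Relation.Unary.Any using (here; there)
open import Data.Nat.ListAction using (sum)
open import Data.Product using (∃-syntax; _×_; _,_; proj₁; proj₂)
open import Function using (_∘_)
open import Relation.Binary.PropositionalEquality using (refl; ≢-sym; sym; trans; cong; cong₂; subst; subst₂; module ≡-Reasoning)
open import Relation.Nullary using (Dec; yes; no; contradiction)
open import Relation.Nullary.Decidable using (¬?)
open import Relation.Unary using (Decidable)
open import Algebra.Properties.CommutativeSemigroup +-commutativeSemigroup using (interchange; x∙yz≈y∙xz)

Σ< : ℕ → (ℕ → ℕ) → ℕ
Σ< zero    a = 0
Σ< (suc l) a = a 0 + Σ< l (a ∘ suc)

Σ<-cong : ∀ l {a b : ℕ → ℕ} → (∀ i → i < l → a i ≡ b i) → Σ< l a ≡ Σ< l b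
Σ<-cong zero    eq = refl
Σ<-cong (suc l) eq = cong₂ _+_ (eq 0 z<s) (Σ<-cong l λ i i<l → eq (suc i) (s<s i<l))

Σ<-mono-≤ : ∀ l {a b : ℕ → ℕ} → (∀ i → i < l → a i ≤ b i) → Σ< l a ≤ Σ< l b
Σ<-mono-≤ zero    le = z≤n
Σ<-mono-≤ (suc l) le = +-mono-≤ (le 0 z<s) (Σ<-mono-≤ l λ i i<l → le (suc i) (s<s i<l))

Σ<-distrib-+ : ∀ l (a b : ℕ → ℕ) → Σ< l (λ i → a i + b i) ≡ Σ< l a + Σ< l b
Σ<-distrib-+ zero    a b = refl
Σ<-distrib-+ (suc l) a b = begin
  (a 0 + b 0) + Σ< l (λ i → a (suc i) + b (suc i))  ≡⟨ cong (a 0 + b 0 +_) (Σ<-distrib-+ l (a ∘ suc) (b ∘ suc)) ⟩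
  (a 0 + b 0) + (Σ< l (a ∘ suc) + Σ< l (b ∘ suc))  ≡⟨ interchange (a 0) (b 0) _ _ ⟩
  (a 0 + Σ< l (a ∘ suc)) + (b 0 + Σ< l (b ∘ suc))  ∎
  where open ≡-Reasoning

Σ<-*ˡ : ∀ l c (a : ℕ → ℕ) → Σ< l (λ i → c * a i) ≡ c * Σ< l a
Σ<-*ˡ zero    c a = sym (*-zeroʳ c)
Σ<-*ˡ (suc l) c a = trans (cong (c * a 0 +_) (Σ<-*ˡ l c (a ∘ suc))) (sym (*-distribˡ-+ c (a 0) _))

Σ<-const : ∀ l c → Σ< l (λ _ → c) ≡ l * c
Σ<-const zero    c = refl
Σ<-const (suc l) c = cong (c +_) (Σ<-const l c)

Σ<-suc : ∀ l (a : ℕ → ℕ) → Σ< (suc l) a ≡ Σ< l a + a l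
Σ<-suc zero    a = +-comm (a 0) 0
Σ<-suc (suc l) a = trans (cong (a 0 +_) (Σ<-suc l (a ∘ suc))) (sym (+-assoc (a 0) _ _))

Σ<-periodic : ∀ l (a : ℕ → ℕ) → a l ≡ a 0 → Σ< l (a ∘ suc) ≡ Σ< l a
Σ<-periodic l a al≡a0 = +-cancelˡ-≡ (a 0) _ _ (begin
  a 0 + Σ< l (a ∘ suc)  ≡⟨ Σ<-suc l a ⟩
  Σ< l a + a l          ≡⟨ cong (Σ< l a +_) al≡a0 ⟩
  Σ< l a + a 0          ≡⟨ +-comm (Σ< l a) (a 0) ⟩
  a 0 + Σ< l a          ∎)
  where open ≡-Reasoning

Σ<-≤-≡⇒≡ : ∀ l {a b : ℕ → ℕ} → (∀ i → i < l → a i ≤ b i) → Σ< l a ≡ Σ< l b →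
           ∀ i → i < l → a i ≡ b i
Σ<-≤-≡⇒≡ (suc l) {a} {b} a≤b eq = λ where
    zero    _     → a₀≡b₀
    (suc i) i<1+l → Σ<-≤-≡⇒≡ l tail-≤ tail-≡ i (s<s⁻¹ i<1+l)
  where
  tail-≤ : ∀ i → i < l → a (suc i) ≤ b (suc i)
  tail-≤ i = a≤b (suc i) ∘ s<s
  a₀≡b₀ : a 0 ≡ b 0
  a₀≡b₀ = ≤-antisym (a≤b 0 z<s) (+-cancelʳ-≤ (Σ< l (b ∘ suc)) (b 0) (a 0)
                      (subst (_≤ a 0 + Σ< l (b ∘ suc)) eq (+-monoʳ-≤ (a 0) (Σ<-mono-≤ l tail-≤))))
  tail-≡ : Σ< l (a ∘ suc) ≡ Σ< l (b ∘ suc)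
  tail-≡ = +-cancelˡ-≡ (a 0) _ _ (trans eq (cong (_+ Σ< l (b ∘ suc)) (sym a₀≡b₀)))

𝟙[_] : {A : Set} → Dec A → ℕ
𝟙[ yes _ ] = 1
𝟙[ no  _ ] = 0

𝟙≤1 : {A : Set} (d : Dec A) → 𝟙[ d ] ≤ 1
𝟙≤1 (yes _) = ≤-refl
𝟙≤1 (no  _) = z≤n

length-filter-applyUpTo : ∀ {P : ℕ → Set} (P? : Decidable P) (f : ℕ → ℕ) l →
                          length (filter P? (applyUpTo f l)) ≡ Σ< l (λ i → 𝟙[ P? (f i) ])
length-filter-applyUpTo P? f zero    = refl
length-filter-applyUpTo P? f (suc l) with P? (f 0)
... | yes _ = cong suc (length-filter-applyUpTo P? (f ∘ suc) l)
... | no  _ = length-filter-applyUpTo P? (f ∘ suc) l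

sum-map-cong : ∀ (xs : List ℕ) {f g : ℕ → ℕ} → (∀ x → x ∈ xs → f x ≡ g x) →
               sum (map f xs) ≡ sum (map g xs)
sum-map-cong xs eq = cong sum (map-cong-local (tabulate λ {x} → eq x))

sum-map-+ : ∀ (xs : List ℕ) (f g : ℕ → ℕ) →
            sum (map (λ x → f x + g x) xs) ≡ sum (map f xs) + sum (map g xs)
sum-map-+ []       f g = refl
sum-map-+ (x ∷ xs) f g = trans (cong (f x + g x +_) (sum-map-+ xs f g)) (interchange (f x) (g x) _ _)

sum-map-*ˡ : ∀ (xs : List ℕ) c (f : ℕ → ℕ) → sum (map (λ x → c * f x) xs) ≡ c * sum (map f xs)
sum-map-*ˡ []       c f = sym (*-zeroʳ c)
sum-map-*ˡ (x ∷ xs) c f = trans (cong (c * f x +_) (sum-map-*ˡ xs c f)) (sym (*-distribˡ-+ c (f x) _))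

sum-map-Σ< : ∀ (xs : List ℕ) l (a : ℕ → ℕ → ℕ) →
             sum (map (λ x → Σ< l (a x)) xs) ≡ Σ< l (λ i → sum (map (λ x → a x i) xs))
sum-map-Σ< []       l a = sym (trans (Σ<-const l 0) (*-zeroʳ l))
sum-map-Σ< (x ∷ xs) l a = trans (cong (Σ< l (a x) +_) (sum-map-Σ< xs l a))
                                (sym (Σ<-distrib-+ l (a x) λ i → sum (map (λ y → a y i) xs)))

sum-weighted-≤ : ∀ (xs : List ℕ) {M} (t : ℕ → ℕ) → (∀ x → x ∈ xs → x ≤ M) →
                 sum (map (λ x → x * t x) xs) ≤ M * sum (map t xs)
sum-weighted-≤ []       t le = z≤n
sum-weighted-≤ (x ∷ xs) {M} t le = begin
  x * t x + sum (map (λ y → y * t y) xs)  ≤⟨ +-mono-≤ (*-monoˡ-≤ (t x) (le x (here refl)))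
                                                        (sum-weighted-≤ xs t (λ y → le y ∘ there)) ⟩
  M * t x + M * sum (map t xs)            ≡⟨ *-distribˡ-+ M (t x) _ ⟨
  M * (t x + sum (map t xs))              ∎
  where open ≤-Reasoning

[m+kn]%n≡m : ∀ {m} k {n} .{{_ : NonZero n}} → m < n → (m + k * n) % n ≡ m
[m+kn]%n≡m {m} k {n} m<n = trans ([m+kn]%n≡m%n m k n) (m<n⇒m%n≡m m<n)

[m+kn]/n≡k : ∀ {m} k {n} .{{_ : NonZero n}} → m < n → (m + k * n) / n ≡ k
[m+kn]/n≡k {m} k {n} m<n = begin
  (m + k * n) / n    ≡⟨ +-distrib-/ m (k * n) remainders<n ⟩
  m / n + k * n / n  ≡⟨ cong₂ _+_ (m<n⇒m/n≡0 m<n) (m*n/n≡m k n) ⟩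
  k                  ∎
  where
  open ≡-Reasoning
  remainders<n : m % n + k * n % n < n
  remainders<n = subst (_< n) (sym (trans (cong₂ _+_ (m<n⇒m%n≡m m<n) (m*n%n≡0 k n)) (+-identityʳ m))) m<n

mod≡% : ∀ m n .{{_ : NonZero n}} → m mod n ≡ m % n
mod≡% m (suc n) = refl

div≡/ : ∀ m n .{{_ : NonZero n}} → m div n ≡ m / n
div≡/ m (suc n) = refl

shift-fixed : ∀ p ℓ {j} → j ≡ p ^ ℓ ∸ 1 → shift p ℓ j ≡ j
shift-fixed p ℓ {j} j≡N with j ≟ p ^ ℓ ∸ 1
... | yes _   = refl
... | no  j≢N = contradiction j≡N j≢N

shift-moved : ∀ p ℓ {j} → j ≢ p ^ ℓ ∸ 1 → shift p ℓ j ≡ (p * j) mod (p ^ ℓ ∸ 1)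
shift-moved p ℓ {j} j≢N with j ≟ p ^ ℓ ∸ 1
... | yes j≡N = contradiction j≡N j≢N
... | no  _   = refl

shiftIter-suc : ∀ p ℓ i j → shiftIter p ℓ (suc i) j ≡ shiftIter p ℓ i (shift p ℓ j)
shiftIter-suc p ℓ zero    j = refl
shiftIter-suc p ℓ (suc i) j = cong (shift p ℓ) (shiftIter-suc p ℓ i j)

module _ (k : ℕ) where

  p : ℕ
  p = suc (suc k)

  1<p : 1 < p
  1<p = s<s z<s

  ^-≤-<⇒< : ∀ {a b x} → p ^ a ≤ x → x < p ^ b → a < b
  ^-≤-<⇒< {a} {b} pᵃ≤x x<pᵇ with a <? b
  ... | yes a<b = a<b
  ... | no  a≮b = contradiction (<-≤-trans x<pᵇ (≤-trans (^-monoʳ-≤ p (≮⇒≥ a≮b)) pᵃ≤x)) (<-irrefl refl)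

  logFuel : ℕ → ℕ → ℕ
  logFuel zero    x = 0
  logFuel (suc F) x with p ≤? x
  ... | yes _ = suc (logFuel F (x / p))
  ... | no  _ = 0

  logFuel-bounds : ∀ F {x} → 0 < x → x ≤ F → p ^ logFuel F x ≤ x × x < p ^ suc (logFuel F x)
  logFuel-bounds zero    z<s ()
  logFuel-bounds (suc F) {x} 0<x x≤1+F with p ≤? x
  ... | no  p≰x = 0<x , subst (x <_) (sym (*-identityʳ p)) (≰⇒> p≰x)
  ... | yes p≤x = lower , upper
    where
    q = x / p
    instance _ = >-nonZero 0<x
    bounds = logFuel-bounds F (m≥n⇒m/n>0 p≤x) (<⇒≤pred (<-≤-trans (m/n<m x p 1<p) x≤1+F))
    lower : p * p ^ logFuel F q ≤ x
    lower = ≤-trans (*-monoʳ-≤ p (proj₁ bounds)) (subst (_≤ x) (*-comm q p) (m/n*n≤m x p))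
    upper : x < p * (p * p ^ logFuel F q)
    upper = begin-strict
      x                       ≡⟨ m≡m%n+[m/n]*n x p ⟩
      x % p + q * p           <⟨ +-monoˡ-< (q * p) (m%n<n x p) ⟩
      p + q * p               ≡⟨ *-comm (suc q) p ⟩
      p * suc q               ≤⟨ *-monoʳ-≤ p (proj₂ bounds) ⟩
      p * (p * p ^ logFuel F q) ∎
      where open ≤-Reasoning

  ⌊log_⌋ : ℕ → ℕ
  ⌊log x ⌋ = logFuel x x

  ⌊log⌋-bounds : ∀ {x} → 0 < x → p ^ ⌊log x ⌋ ≤ x × x < p ^ suc ⌊log x ⌋
  ⌊log⌋-bounds {x} 0<x = logFuel-bounds x 0<x ≤-refl

  ⌊log⌋-*p : ∀ {x} → 0 < x → ⌊log (p * x) ⌋ ≡ suc ⌊log x ⌋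
  ⌊log⌋-*p {x} 0<x = ≤-antisym (<⇒≤pred (^-≤-<⇒< (proj₁ px-bounds) (*-monoʳ-< p (proj₂ x-bounds))))
                                (≤-pred (^-≤-<⇒< (*-monoʳ-≤ p (proj₁ x-bounds)) (proj₂ px-bounds)))
    where
    x-bounds  = ⌊log⌋-bounds 0<x
    px-bounds = ⌊log⌋-bounds (<-≤-trans 0<x (m≤n*m x p))

  jump : (ℕ → ℕ) → ℕ → ℕ
  jump f i = 𝟙[ ¬? (f (suc i) ≟ p * f i) ]

  module Orbit (n ℓ : ℕ) (f c : ℕ → ℕ)
               (step   : ∀ i → f (suc i) + c i ≡ p * f i)
               (carry  : ∀ i → i < ℓ → c i + p ≤ p ^ suc n)
               (period : f ℓ ≡ f 0)
               (0<f0   : 0 < f 0) where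

    K : ℕ
    K = p ^ suc n

    rises : ∀ i → i < ℓ → K ≤ f i → f i < f (suc i)
    rises i i<ℓ K≤fi = +-cancelʳ-< (c i) (f i) (f (suc i)) (begin-strict
      f i + c i        <⟨ +-monoʳ-< (f i) (<-≤-trans (m<m+n (c i) z<s) (carry i i<ℓ)) ⟩
      f i + K          ≤⟨ +-monoʳ-≤ (f i) K≤fi ⟩
      f i + f i        ≡⟨ cong (f i +_) (+-identityʳ (f i)) ⟨
      2 * f i          ≤⟨ *-monoˡ-≤ (f i) {2} {p} (s<s z<s) ⟩
      p * f i          ≡⟨ step i ⟨
      f (suc i) + c i  ∎)
      where open ≤-Reasoning

    climb : ∀ j i → i + j ≤ ℓ → K ≤ f i → f i + j ≤ f (i + j)
    climb zero    i _ _ = ≤-reflexive (trans (+-identityʳ (f i)) (cong f (sym (+-identityʳ i))))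
    climb (suc j) i i+1+j≤ℓ K≤fi = begin
      f i + suc j      ≡⟨ +-suc (f i) j ⟩
      suc (f i) + j    ≤⟨ +-monoˡ-≤ j fi<fi+1 ⟩
      f (suc i) + j    ≤⟨ climb j (suc i) (subst (_≤ ℓ) (+-suc i j) i+1+j≤ℓ) (≤-trans K≤fi (<⇒≤ fi<fi+1)) ⟩
      f (suc i + j)    ≡⟨ cong f (+-suc i j) ⟨
      f (i + suc j)    ∎
      where
      open ≤-Reasoning
      fi<fi+1 = rises i (<-≤-trans (m<m+n i z<s) i+1+j≤ℓ) K≤fi

    climb-to-end : ∀ i → i ≤ ℓ → K ≤ f i → f i + (ℓ ∸ i) ≤ f 0
    climb-to-end i i≤ℓ K≤fi =
      ≤-trans (climb (ℓ ∸ i) i (≤-reflexive (m+[n∸m]≡n i≤ℓ)) K≤fi) (≤-reflexive (trans (cong f (m+[n∸m]≡n i≤ℓ)) period))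

    -- Once f i ≥ p ^ suc n the orbit strictly increases up to ℓ, contradicting f ℓ ≡ f 0.
    f<K : ∀ i → i < ℓ → f i < K
    f<K i i<ℓ with K ≤? f i
    ... | no  K≰fi = ≰⇒> K≰fi
    ... | yes K≤fi = contradiction (climb-to-end 0 z≤n K≤f0) (<⇒≱ (m<m+n (f 0) (<-≤-trans z<s i<ℓ)))
      where K≤f0 = ≤-trans K≤fi (≤-trans (m≤m+n (f i) _) (climb-to-end i (<⇒≤ i<ℓ) K≤fi))

    zero-step : ∀ i → f i ≡ 0 → f (suc i) ≡ 0
    zero-step i fi≡0 = m+n≡0⇒m≡0 (f (suc i)) (trans (step i) (trans (cong (p *_) fi≡0) (*-zeroʳ p)))

    zero-forever : ∀ j i → f i ≡ 0 → f (i + j) ≡ 0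
    zero-forever zero    i fi≡0 = trans (cong f (+-identityʳ i)) fi≡0
    zero-forever (suc j) i fi≡0 = trans (cong f (+-suc i j)) (zero-forever j (suc i) (zero-step i fi≡0))

    0<f : ∀ i → i < ℓ → 0 < f i
    0<f i i<ℓ with f i ≟ 0
    ... | no  fi≢0 = n≢0⇒n>0 fi≢0
    ... | yes fi≡0 = contradiction (trans (sym period) (trans (cong f (sym (m+[n∸m]≡n (<⇒≤ i<ℓ)))) (zero-forever (ℓ ∸ i) i fi≡0)))
                                   (≢-sym (<⇒≢ 0<f0))

    h : ℕ → ℕ
    h i = ⌊log f i ⌋

    h≤n : ∀ i → i < ℓ → h i ≤ n
    h≤n i i<ℓ = <⇒≤pred (^-≤-<⇒< (proj₁ (⌊log⌋-bounds (0<f i i<ℓ))) (f<K i i<ℓ))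

    p≤next : ∀ i → i < ℓ → p ^ n ≤ f i → p ≤ f (suc i)
    p≤next i i<ℓ pⁿ≤fi = +-cancelˡ-≤ (c i) p (f (suc i)) (begin
      c i + p          ≤⟨ carry i i<ℓ ⟩
      p * p ^ n        ≤⟨ *-monoʳ-≤ p pⁿ≤fi ⟩
      p * f i          ≡⟨ step i ⟨
      f (suc i) + c i  ≡⟨ +-comm (f (suc i)) (c i) ⟩
      c i + f (suc i)  ∎)
      where open ≤-Reasoning

    1≤h-next : ∀ i → i < ℓ → n ≤ h i → 1 ≤ h (suc i)
    1≤h-next i i<ℓ n≤hi = ≤-pred (^-≤-<⇒< (subst (_≤ f (suc i)) (sym (*-identityʳ p)) p≤fi+1) (proj₂ (⌊log⌋-bounds 0<fi+1)))
      where
      pⁿ≤fi  = ≤-trans (^-monoʳ-≤ p n≤hi) (proj₁ (⌊log⌋-bounds (0<f i i<ℓ)))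
      p≤fi+1 = p≤next i i<ℓ pⁿ≤fi
      0<fi+1 = <-≤-trans z<s p≤fi+1

    log-step : ∀ i → i < ℓ → (d : Dec (f (suc i) ≡ p * f i)) → suc (h i) ≤ h (suc i) + n * 𝟙[ ¬? d ]
    log-step i i<ℓ (yes flat) = ≤-reflexive (begin
      suc (h i)        ≡⟨ ⌊log⌋-*p (0<f i i<ℓ) ⟨
      ⌊log p * f i ⌋   ≡⟨ cong ⌊log_⌋ flat ⟨
      h (suc i)        ≡⟨ +-identityʳ (h (suc i)) ⟨
      h (suc i) + 0    ≡⟨ cong (h (suc i) +_) (*-zeroʳ n) ⟨
      h (suc i) + n * 0 ∎)
      where open ≡-Reasoning
    log-step i i<ℓ (no _) with n ≤? h i
    ... | no  n≰hi = ≤-trans (≰⇒> n≰hi) (≤-trans (≤-reflexive (sym (*-identityʳ n))) (m≤n+m _ _))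
    ... | yes n≤hi = ≤-trans (s≤s (h≤n i i<ℓ)) (+-mono-≤ (1≤h-next i i<ℓ n≤hi) (≤-reflexive (sym (*-identityʳ n))))

    ℓ≤n*jumps : ℓ ≤ n * Σ< ℓ (jump f)
    ℓ≤n*jumps = +-cancelʳ-≤ (Σ< ℓ h) ℓ (n * Σ< ℓ (jump f)) (begin
      ℓ + Σ< ℓ h                                    ≡⟨ cong (_+ Σ< ℓ h) (trans (Σ<-const ℓ 1) (*-identityʳ ℓ)) ⟨
      Σ< ℓ (λ _ → 1) + Σ< ℓ h                       ≡⟨ Σ<-distrib-+ ℓ (λ _ → 1) h ⟨
      Σ< ℓ (λ i → suc (h i))                        ≤⟨ Σ<-mono-≤ ℓ (λ i i<ℓ → log-step i i<ℓ (f (suc i) ≟ p * f i)) ⟩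
      Σ< ℓ (λ i → h (suc i) + n * jump f i)         ≡⟨ Σ<-distrib-+ ℓ (h ∘ suc) (λ i → n * jump f i) ⟩
      Σ< ℓ (h ∘ suc) + Σ< ℓ (λ i → n * jump f i)    ≡⟨ cong₂ _+_ (Σ<-periodic ℓ h (cong ⌊log_⌋ period)) (Σ<-*ˡ ℓ n (jump f)) ⟩
      Σ< ℓ h + n * Σ< ℓ (jump f)                    ≡⟨ +-comm (Σ< ℓ h) _ ⟩
      n * Σ< ℓ (jump f) + Σ< ℓ h                    ∎)
      where open ≤-Reasoning

  digitSumAux-fuel : ∀ {F G} x → x ≤ F → x ≤ G → digitSumAux p F x ≡ digitSumAux p G x
  digitSumAux-fuel {zero}  {zero}  zero _ _ = refl
  digitSumAux-fuel {zero}  {suc _} zero _ _ = refl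
  digitSumAux-fuel {suc _} {zero}  zero _ _ = refl
  digitSumAux-fuel {suc _} {suc _} zero _ _ = refl
  digitSumAux-fuel (suc x) (s≤s x≤F) (s≤s x≤G) =
    cong (suc x % p +_) (digitSumAux-fuel (suc x / p) (≤-trans q≤x x≤F) (≤-trans q≤x x≤G))
    where q≤x = <⇒≤pred (m/n<m (suc x) p 1<p)

  digitSum-unfold : ∀ x → digitSum p x ≡ x % p + digitSum p (x / p)
  digitSum-unfold zero    = refl
  digitSum-unfold (suc x) = cong (suc x % p +_) (digitSumAux-fuel (suc x / p) (<⇒≤pred (m/n<m (suc x) p 1<p)) ≤-refl)

  digitSum-digit : ∀ {t} → t < p → digitSum p t ≡ t
  digitSum-digit {t} t<p = begin
    digitSum p t                ≡⟨ digitSum-unfold t ⟩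
    t % p + digitSum p (t / p)  ≡⟨ cong₂ (λ a b → a + digitSum p b) (m<n⇒m%n≡m t<p) (m<n⇒m/n≡0 t<p) ⟩
    t + 0                       ≡⟨ +-identityʳ t ⟩
    t                           ∎
    where open ≡-Reasoning

  digitSum-leading : ∀ j {t x} → t < p → x < p ^ j → digitSum p (t * p ^ j + x) ≡ t + digitSum p x
  digitSum-leading zero {t} {zero} t<p _ = begin
    digitSum p (t * 1 + 0)  ≡⟨ cong (digitSum p) (trans (+-identityʳ _) (*-identityʳ t)) ⟩
    digitSum p t            ≡⟨ digitSum-digit t<p ⟩
    t                       ≡⟨ +-identityʳ t ⟨
    t + 0                   ∎
    where open ≡-Reasoning
  digitSum-leading zero {x = suc _} _ (s≤s ())
  digitSum-leading (suc j) {t} {x} t<p x<pʲ⁺¹ = begin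
    digitSum p y                                  ≡⟨ digitSum-unfold y ⟩
    y % p + digitSum p (y / p)                    ≡⟨ cong₂ (λ a b → a + digitSum p b) y%p y/p ⟩
    x % p + digitSum p (t * p ^ j + x / p)        ≡⟨ cong (x % p +_) (digitSum-leading j t<p x/p<pʲ) ⟩
    x % p + (t + digitSum p (x / p))              ≡⟨ x∙yz≈y∙xz (x % p) t _ ⟩
    t + (x % p + digitSum p (x / p))              ≡⟨ cong (t +_) (digitSum-unfold x) ⟨
    t + digitSum p x                              ∎
    where
    open ≡-Reasoning
    y = t * p ^ suc j + x
    x/p<pʲ : x / p < p ^ j
    x/p<pʲ = m<n*o⇒m/o<n (subst (x <_) (*-comm p (p ^ j)) x<pʲ⁺¹)
    regroup : ∀ p t P r q → t * (P * p) + (r + q * p) ≡ r + (t * P + q) * p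
    regroup = solve-∀
    y≡ : y ≡ x % p + (t * p ^ j + x / p) * p
    y≡ = trans (cong₂ (λ P x → t * P + x) (*-comm p (p ^ j)) (m≡m%n+[m/n]*n x p)) (regroup p t (p ^ j) (x % p) (x / p))
    y%p = trans (cong (_% p) y≡) ([m+kn]%n≡m (t * p ^ j + x / p) (m%n<n x p))
    y/p = trans (cong (_/ p) y≡) ([m+kn]/n≡k (t * p ^ j + x / p) (m%n<n x p))

  module Rotation (m : ℕ) where

    P N : ℕ
    P = p ^ m
    N = p * P ∸ 1

    instance
      P≢0 : NonZero P
      P≢0 = m^n≢0 p m

    1+N≡pP : suc N ≡ p * P
    1+N≡pP = trans (+-comm 1 N) (m∸n+n≡m (m^n>0 p (suc m)))

    -- δ = p − 1 − t and ε = P − 1 − r are the complementary digits, so t P + r = N iff δ = ε = 0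
    -- iff t + p r = N: the value N fixed by shift is the digit rotation of itself.
    complements : ∀ {t r} → t < p → r < P →
                  ∃[ δ ] ∃[ ε ] (N ≡ (t * P + r) + (δ * P + ε) × N ≡ (t + p * r) + (δ + p * ε))
    complements {t} {r} t<p r<P with δ , t+1+δ≡p ← m≤n⇒∃[o]m+o≡n t<p | ε , r+1+ε≡P ← m≤n⇒∃[o]m+o≡n r<P =
      δ , ε , suc-injective (via (λ q Q → (t * Q + r) + (δ * Q + ε)) (expand₁ t δ r ε))
            , suc-injective (via (λ q Q → (t + q * r) + (δ + q * ε)) (expand₂ t δ r ε))
      where
      expand₁ : ∀ t δ r ε → (suc t + δ) * (suc r + ε) ≡ suc ((t * (suc r + ε) + r) + (δ * (suc r + ε) + ε))
      expand₁ = solve-∀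
      expand₂ : ∀ t δ r ε → (suc t + δ) * (suc r + ε) ≡ suc ((t + (suc t + δ) * r) + (δ + (suc t + δ) * ε))
      expand₂ = solve-∀
      via : ∀ (g : ℕ → ℕ → ℕ) → (suc t + δ) * (suc r + ε) ≡ suc (g (suc t + δ) (suc r + ε)) → suc N ≡ suc (g p P)
      via g expanded = trans 1+N≡pP (subst₂ (λ q Q → q * Q ≡ suc (g q Q)) t+1+δ≡p r+1+ε≡P expanded)

    complements-vanish : ∀ δ ε → δ * P + ε ≡ 0 → δ + p * ε ≡ 0
    complements-vanish δ ε e = trans (cong₂ (λ a b → a + p * b) δ≡0 ε≡0) (*-zeroʳ p)
      where
      ε≡0 = m+n≡0⇒n≡0 (δ * P) e
      δ≡0 = m*n≡0⇒m≡0 δ P (m+n≡0⇒m≡0 (δ * P) e)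

    complements-vanish⁻ : ∀ δ ε → δ + p * ε ≡ 0 → δ * P + ε ≡ 0
    complements-vanish⁻ δ ε e = cong₂ (λ a b → a * P + b) δ≡0 ε≡0
      where
      δ≡0 = m+n≡0⇒m≡0 δ e
      ε≡0 = m*n≡0⇒m≡0 ε p (trans (*-comm ε p) (m+n≡0⇒n≡0 δ e))

    gap-zero : ∀ {x g} → N ≡ x + g → x ≡ N → g ≡ 0
    gap-zero {x} {g} N≡x+g x≡N = +-cancelˡ-≡ x g 0 (trans (sym N≡x+g) (trans (sym x≡N) (sym (+-identityʳ x))))

    gap-closed : ∀ {x g} → N ≡ x + g → g ≡ 0 → x ≡ N
    gap-closed {x} N≡x+g g≡0 = trans (sym (+-identityʳ x)) (trans (cong (x +_) (sym g≡0)) (sym N≡x+g))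

    p*[tP+r]≡[t+pr]+tN : ∀ t r → p * (t * P + r) ≡ (t + p * r) + t * N
    p*[tP+r]≡[t+pr]+tN t r = begin
      p * (t * P + r)       ≡⟨ distribute p t P r ⟩
      t * (p * P) + p * r   ≡⟨ cong (λ Q → t * Q + p * r) 1+N≡pP ⟨
      t * suc N + p * r     ≡⟨ regroup t N (p * r) ⟩
      (t + p * r) + t * N   ∎
      where
      open ≡-Reasoning
      distribute : ∀ p t P r → p * (t * P + r) ≡ t * (p * P) + p * r
      distribute = solve-∀
      regroup : ∀ t N x → t * suc N + x ≡ (t + x) + t * N
      regroup = solve-∀

    shift-leading : ∀ {t r} → t < p → r < P → shift p (suc m) (t * P + r) ≡ t + p * r
    shift-leading {t} {r} t<p r<P with δ , ε , v-gap , s-gap ← complements t<p r<P = by-cases (t * P + r ≟ N)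
      where
      open ≡-Reasoning
      by-cases : Dec (t * P + r ≡ N) → shift p (suc m) (t * P + r) ≡ t + p * r
      by-cases (yes v≡N) = begin
        shift p (suc m) (t * P + r)  ≡⟨ shift-fixed p (suc m) v≡N ⟩
        t * P + r                    ≡⟨ v≡N ⟩
        N                            ≡⟨ gap-closed s-gap (complements-vanish δ ε (gap-zero v-gap v≡N)) ⟨
        t + p * r                    ∎
      by-cases (no v≢N) = begin
        shift p (suc m) (t * P + r)  ≡⟨ shift-moved p (suc m) v≢N ⟩
        (p * (t * P + r)) mod N      ≡⟨ mod≡% _ N ⟩
        p * (t * P + r) % N          ≡⟨ cong (_% N) (p*[tP+r]≡[t+pr]+tN t r) ⟩
        (t + p * r + t * N) % N      ≡⟨ [m+kn]%n≡m t s<N ⟩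
        t + p * r                    ∎
        where
        s<N : t + p * r < N
        s<N = ≤∧≢⇒< (subst (t + p * r ≤_) (sym s-gap) (m≤m+n _ _))
                    (λ s≡N → v≢N (gap-closed v-gap (complements-vanish⁻ δ ε (gap-zero s-gap s≡N))))
        instance
          N≢0 : NonZero N
          N≢0 = >-nonZero (≤-<-trans z≤n s<N)

    rotated<pP : ∀ {t r} → t < p → r < P → t + p * r < p * P
    rotated<pP {t} {r} t<p r<P with δ , ε , _ , s-gap ← complements t<p r<P =
      subst (t + p * r <_) 1+N≡pP (s≤s (subst (t + p * r ≤_) (sym s-gap) (m≤m+n (t + p * r) (δ + p * ε))))

    leading-split : ∀ v → v ≡ (v / P) * P + v % P
    leading-split v = trans (m≡m%n+[m/n]*n v P) (+-comm (v % P) _)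

    shift-equation : ∀ {v} → v < p * P → p * v ≡ shift p (suc m) v + (v / P) * N
    shift-equation {v} v<pP = begin
      p * v                                    ≡⟨ cong (p *_) (leading-split v) ⟩
      p * ((v / P) * P + v % P)                ≡⟨ p*[tP+r]≡[t+pr]+tN (v / P) (v % P) ⟩
      (v / P + p * (v % P)) + (v / P) * N      ≡⟨ cong (_+ (v / P) * N) (shift-leading (m<n*o⇒m/o<n v<pP) (m%n<n v P)) ⟨
      shift p (suc m) ((v / P) * P + v % P) + (v / P) * N  ≡⟨ cong (λ u → shift p (suc m) u + (v / P) * N) (leading-split v) ⟨
      shift p (suc m) v + (v / P) * N         ∎
      where open ≡-Reasoning

    shift-< : ∀ {v} → v < p * P → shift p (suc m) v < p * P
    shift-< {v} v<pP = subst (_< p * P) shifted (rotated<pP (m<n*o⇒m/o<n v<pP) (m%n<n v P))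
      where
      shifted : v / P + p * (v % P) ≡ shift p (suc m) v
      shifted = trans (sym (shift-leading (m<n*o⇒m/o<n v<pP) (m%n<n v P))) (cong (shift p (suc m)) (sym (leading-split v)))

    shiftIter-< : ∀ {v} → v < p * P → ∀ i → shiftIter p (suc m) i v < p * P
    shiftIter-< v<pP zero    = v<pP
    shiftIter-< v<pP (suc i) = shift-< (shiftIter-< v<pP i)

    top-digit : ∀ i {b} → b < p ^ suc i → ∃[ t ] ∃[ x ] (b ≡ t * p ^ i + x × t < p × x < p ^ i)
    top-digit i {b} b<pⁱ⁺¹ = b / p ^ i , b % p ^ i
                           , trans (m≡m%n+[m/n]*n b (p ^ i)) (+-comm (b % p ^ i) _)
                           , m<n*o⇒m/o<n b<pⁱ⁺¹ , m%n<n b (p ^ i)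
      where instance _ = m^n≢0 p i

    shift-top : ∀ i j {t x a} → i + j ≡ m → t < p → x < p ^ i → a < p ^ j →
                ((t * p ^ i + x) * p ^ j + a) / P ≡ t ×
                shift p (suc m) ((t * p ^ i + x) * p ^ j + a) ≡ x * p ^ suc j + (p * a + t)
    shift-top i j {t} {x} {a} i+j≡m t<p x<pⁱ a<pʲ = leading , rotated
      where
      rest = x * p ^ j + a
      P≡pⁱpʲ : P ≡ p ^ i * p ^ j
      P≡pⁱpʲ = trans (cong (p ^_) (sym i+j≡m)) (^-distribˡ-+-* p i j)
      rest<P : rest < P
      rest<P = begin-strict
        x * p ^ j + a      <⟨ +-monoʳ-< (x * p ^ j) a<pʲ ⟩
        x * p ^ j + p ^ j  ≡⟨ +-comm (x * p ^ j) _ ⟩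
        suc x * p ^ j      ≤⟨ *-monoˡ-≤ (p ^ j) x<pⁱ ⟩
        p ^ i * p ^ j      ≡⟨ P≡pⁱpʲ ⟨
        P                  ∎
        where open ≤-Reasoning
      u≡rest+tP : (t * p ^ i + x) * p ^ j + a ≡ rest + t * P
      u≡rest+tP = trans (regroup t (p ^ i) x (p ^ j) a) (cong (λ Q → rest + t * Q) (sym P≡pⁱpʲ))
        where
        regroup : ∀ t A x B a → (t * A + x) * B + a ≡ (x * B + a) + t * (A * B)
        regroup = solve-∀
      leading = trans (cong (_/ P) u≡rest+tP) ([m+kn]/n≡k t rest<P)
      rotated = begin
        shift p (suc m) ((t * p ^ i + x) * p ^ j + a)  ≡⟨ cong (shift p (suc m)) (trans u≡rest+tP (+-comm rest (t * P))) ⟩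
        shift p (suc m) (t * P + rest)                 ≡⟨ shift-leading t<p rest<P ⟩
        t + p * rest                                   ≡⟨ regroup p t x (p ^ j) a ⟩
        x * p ^ suc j + (p * a + t)                    ∎
        where
        open ≡-Reasoning
        regroup : ∀ p t x B a → t + p * (x * B + a) ≡ x * (p * B) + (p * a + t)
        regroup = solve-∀

    p*a+t<pʲ⁺¹ : ∀ j {a t} → a < p ^ j → t < p → p * a + t < p ^ suc j
    p*a+t<pʲ⁺¹ j {a} {t} a<pʲ t<p = begin-strict
      p * a + t   <⟨ +-monoʳ-< (p * a) t<p ⟩
      p * a + p   ≡⟨ +-comm (p * a) p ⟩
      p + p * a   ≡⟨ *-suc p a ⟨
      p * suc a   ≤⟨ *-monoʳ-≤ p a<pʲ ⟩
      p * p ^ j   ∎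
      where open ≤-Reasoning

    rotate : ∀ i j {a b} → i + j ≡ suc m → a < p ^ j → b < p ^ i →
             shiftIter p (suc m) i (b * p ^ j + a) ≡ a * p ^ i + b
    rotate zero    j {a} {b} _ _ b<1 rewrite n<1⇒n≡0 b<1 = sym (trans (+-identityʳ _) (*-identityʳ a))
    rotate (suc i) j {a} i+1+j≡ℓ a<pʲ b<pⁱ⁺¹ with t , x , refl , t<p , x<pⁱ ← top-digit i b<pⁱ⁺¹ = begin
      shiftIter p (suc m) (suc i) u                          ≡⟨ shiftIter-suc p (suc m) i u ⟩
      shiftIter p (suc m) i (shift p (suc m) u)              ≡⟨ cong (shiftIter p (suc m) i) (proj₂ (shift-top i j (suc-injective i+1+j≡ℓ) t<p x<pⁱ a<pʲ)) ⟩
      shiftIter p (suc m) i (x * p ^ suc j + (p * a + t))    ≡⟨ rotate i (suc j) (trans (+-suc i j) i+1+j≡ℓ) (p*a+t<pʲ⁺¹ j a<pʲ t<p) x<pⁱ ⟩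
      (p * a + t) * p ^ i + x                                ≡⟨ regroup p a t (p ^ i) x ⟩
      a * p ^ suc i + (t * p ^ i + x)                        ∎
      where
      open ≡-Reasoning
      u = (t * p ^ i + x) * p ^ j + a
      regroup : ∀ p a t A x → (p * a + t) * A + x ≡ a * (p * A) + (t * A + x)
      regroup = solve-∀

    leading-digits : ∀ i j {a b} → i + j ≡ suc m → a < p ^ j → b < p ^ i →
                     Σ< i (λ e → shiftIter p (suc m) e (b * p ^ j + a) / P) ≡ digitSum p b
    leading-digits zero    j _ _ b<1 rewrite n<1⇒n≡0 b<1 = refl
    leading-digits (suc i) j {a} i+1+j≡ℓ a<pʲ b<pⁱ⁺¹ with t , x , refl , t<p , x<pⁱ ← top-digit i b<pⁱ⁺¹ = begin
      u / P + Σ< i (λ e → shiftIter p (suc m) (suc e) u / P)                  ≡⟨ cong₂ _+_ (proj₁ top) (Σ<-cong i λ e _ → cong (_/ P) (shiftIter-suc p (suc m) e u)) ⟩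
      t + Σ< i (λ e → shiftIter p (suc m) e (shift p (suc m) u) / P)          ≡⟨ cong (λ v → t + Σ< i (λ e → shiftIter p (suc m) e v / P)) (proj₂ top) ⟩
      t + Σ< i (λ e → shiftIter p (suc m) e (x * p ^ suc j + (p * a + t)) / P) ≡⟨ cong (t +_) (leading-digits i (suc j) (trans (+-suc i j) i+1+j≡ℓ) (p*a+t<pʲ⁺¹ j a<pʲ t<p) x<pⁱ) ⟩
      t + digitSum p x                                                        ≡⟨ digitSum-leading i t<p x<pⁱ ⟨
      digitSum p (t * p ^ i + x)                                              ∎
      where
      open ≡-Reasoning
      u = (t * p ^ i + x) * p ^ j + a
      top = shift-top i j (suc-injective i+1+j≡ℓ) t<p x<pⁱ a<pʲ

    shiftIter-period : ∀ {u} → u < p * P → shiftIter p (suc m) (suc m) u ≡ u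
    shiftIter-period {u} u<pP = trans (cong (shiftIter p (suc m) (suc m)) u≡u*1+0) (rotate (suc m) 0 (+-identityʳ _) z<s u<pP)
      where u≡u*1+0 = sym (trans (+-identityʳ _) (*-identityʳ u))

    leading-digits-sum : ∀ {u} → u < p * P → Σ< (suc m) (λ e → shiftIter p (suc m) e u / P) ≡ digitSum p u
    leading-digits-sum {u} u<pP = trans (Σ<-cong (suc m) λ e _ → cong (λ v → shiftIter p (suc m) e v / P) u≡u*1+0)
                                        (leading-digits (suc m) 0 (+-identityʳ _) z<s u<pP)
      where u≡u*1+0 = sym (trans (+-identityʳ _) (*-identityʳ u))

  maxDlist : ℕ → ℕ
  maxDlist n = p ^ suc n ∸ p ∸ 1

  ∈Dlist⇒≤max : ∀ n {d} → d ∈ Dlist p n → d ≤ maxDlist n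
  ∈Dlist⇒≤max n d∈D with ∈-map⁻ suc (proj₁ (∈-filter⁻ (λ i → gcd i p ≟ 1) {xs = map suc (upTo (maxDlist n))} d∈D))
  ... | x , x∈upTo , refl = ∈-upTo⁻ x∈upTo

  maxDlist+p≤pⁿ⁺¹ : ∀ n → maxDlist n + p ≤ p ^ suc n
  maxDlist+p≤pⁿ⁺¹ n = begin
    maxDlist n + p           ≤⟨ +-monoˡ-≤ p (m∸n≤m (p ^ suc n ∸ p) 1) ⟩
    (p ^ suc n ∸ p) + p      ≡⟨ m∸n+n≡m (m≤m*n p (p ^ n) {{m^n≢0 p n}}) ⟩
    p ^ suc n                ∎
    where open ≤-Reasoning

  module Solution (n m : ℕ) (U : ℕ → ℕ)
                  (U≤N  : ∀ d → d ∈ Dlist p n → U d ≤ p ^ suc m ∸ 1)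
                  (N∣W₀ : (p ^ suc m ∸ 1) ∣ weightedSum p n U)
                  (0<W₀ : 0 < weightedSum p n U) where

    open Rotation m

    ℓ : ℕ
    ℓ = suc m

    D : List ℕ
    D = Dlist p n

    instance
      N≢0 : NonZero N
      N≢0 = >-nonZero (m<n⇒0<n∸m (<-≤-trans 1<p (m≤m*n p P)))

    U<pP : ∀ d → d ∈ D → U d < p * P
    U<pP d d∈D = subst (U d <_) 1+N≡pP (s≤s (U≤N d d∈D))

    V : ℕ → ℕ → ℕ
    V i d = shiftIter p ℓ i (U d)

    W C T φ : ℕ → ℕ
    W i = weightedSum p n (V i)
    C i = sum (map (λ d → d * (V i d / P)) D)
    T i = sum (map (λ d → V i d / P) D)
    φ   = support p n ℓ U

    W-step : ∀ i → W (suc i) + N * C i ≡ p * W i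
    W-step i = begin
      W (suc i) + N * C i
        ≡⟨ cong (W (suc i) +_) (sum-map-*ˡ D N (λ d → d * (V i d / P))) ⟨
      sum (map (λ d → d * V (suc i) d) D) + sum (map (λ d → N * (d * (V i d / P))) D)
        ≡⟨ sum-map-+ D (λ d → d * V (suc i) d) (λ d → N * (d * (V i d / P))) ⟨
      sum (map (λ d → d * V (suc i) d + N * (d * (V i d / P))) D)
        ≡⟨ sum-map-cong D digitwise ⟩
      sum (map (λ d → p * (d * V i d)) D)
        ≡⟨ sum-map-*ˡ D p (λ d → d * V i d) ⟩
      p * W i ∎
      where
      open ≡-Reasoning
      regroup : ∀ d v t N → d * v + N * (d * t) ≡ d * (v + t * N)
      regroup = solve-∀
      left-comm : ∀ d p v → d * (p * v) ≡ p * (d * v)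
      left-comm = solve-∀
      digitwise : ∀ d → d ∈ D → d * V (suc i) d + N * (d * (V i d / P)) ≡ p * (d * V i d)
      digitwise d d∈D = begin
        d * V (suc i) d + N * (d * (V i d / P))  ≡⟨ regroup d (V (suc i) d) (V i d / P) N ⟩
        d * (V (suc i) d + (V i d / P) * N)      ≡⟨ cong (d *_) (shift-equation (shiftIter-< (U<pP d d∈D) i)) ⟨
        d * (p * V i d)                          ≡⟨ left-comm d p (V i d) ⟩
        p * (d * V i d)                          ∎

    N∣W : ∀ i → N ∣ W i
    N∣W zero    = N∣W₀
    N∣W (suc i) = ∣m+n∣m⇒∣n (subst (N ∣_) (trans (sym (W-step i)) (+-comm (W (suc i)) _)) (∣n⇒∣m*n p (N∣W i)))
                            (m∣m*n (C i))

    φ*N≡W : ∀ i → φ i * N ≡ W i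
    φ*N≡W i = trans (cong (_* N) (div≡/ (W i) N)) (m/n*n≡m (N∣W i))

    φ-step : ∀ i → φ (suc i) + C i ≡ p * φ i
    φ-step i = *-cancelʳ-≡ _ _ N (begin
      (φ (suc i) + C i) * N      ≡⟨ *-distribʳ-+ N (φ (suc i)) (C i) ⟩
      φ (suc i) * N + C i * N    ≡⟨ cong₂ _+_ (φ*N≡W (suc i)) (*-comm (C i) N) ⟩
      W (suc i) + N * C i        ≡⟨ W-step i ⟩
      p * W i                    ≡⟨ cong (p *_) (φ*N≡W i) ⟨
      p * (φ i * N)              ≡⟨ *-assoc p (φ i) N ⟨
      p * φ i * N                ∎)
      where open ≡-Reasoning

    φ-period : φ ℓ ≡ φ 0
    φ-period = cong (_div N) (sum-map-cong D λ d d∈D → cong (d *_) (shiftIter-period (U<pP d d∈D)))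

    0<φ₀ : 0 < φ 0
    0<φ₀ = n≢0⇒n>0 λ φ₀≡0 → <⇒≢ 0<W₀ (sym (trans (sym (φ*N≡W 0)) (cong (_* N) φ₀≡0)))

    weight≡ΣT : weight p n U ≡ Σ< ℓ T
    weight≡ΣT = trans (sum-map-cong D λ d d∈D → sym (leading-digits-sum (U<pP d d∈D)))
                      (sum-map-Σ< D ℓ λ d i → V i d / P)

    C≤max*T : ∀ i → C i ≤ maxDlist n * T i
    C≤max*T i = sum-weighted-≤ D (λ d → V i d / P) (λ d → ∈Dlist⇒≤max n)

    jump≤T : ∀ i → jump φ i ≤ T i
    jump≤T i = by-cases (φ (suc i) ≟ p * φ i)
      where
      flat-if-T≡0 : T i ≡ 0 → φ (suc i) ≡ p * φ i
      flat-if-T≡0 Tᵢ≡0 = trans (sym (+-identityʳ _)) (trans (cong (φ (suc i) +_) (sym Cᵢ≡0)) (φ-step i))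
        where Cᵢ≡0 = n≤0⇒n≡0 (subst (C i ≤_) (trans (cong (maxDlist n *_) Tᵢ≡0) (*-zeroʳ (maxDlist n))) (C≤max*T i))
      by-cases : (d : Dec (φ (suc i) ≡ p * φ i)) → 𝟙[ ¬? d ] ≤ T i
      by-cases (yes _)        = z≤n
      by-cases (no  not-flat) = n≢0⇒n>0 (not-flat ∘ flat-if-T≡0)

    jumps≡Σ<jump : jumps p n ℓ U ≡ Σ< ℓ (jump φ)
    jumps≡Σ<jump = length-filter-applyUpTo (λ i → ¬? (φ (suc i) ≟ p * φ i)) (λ i → i) ℓ

    carry-bound : jumps p n ℓ U ≡ weight p n U → ∀ i → i < ℓ → C i + p ≤ p ^ suc n
    carry-bound jumps≡weight i i<ℓ = begin
      C i + p                   ≤⟨ +-monoˡ-≤ p (C≤max*T i) ⟩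
      maxDlist n * T i + p      ≤⟨ +-monoˡ-≤ p (*-monoʳ-≤ (maxDlist n) Tᵢ≤1) ⟩
      maxDlist n * 1 + p        ≡⟨ cong (_+ p) (*-identityʳ (maxDlist n)) ⟩
      maxDlist n + p            ≤⟨ maxDlist+p≤pⁿ⁺¹ n ⟩
      p ^ suc n                 ∎
      where
      open ≤-Reasoning
      Σjump≡ΣT = trans (sym jumps≡Σ<jump) (trans jumps≡weight weight≡ΣT)
      Tᵢ≤1 : T i ≤ 1
      Tᵢ≤1 = subst (_≤ 1) (Σ<-≤-≡⇒≡ ℓ (λ j _ → jump≤T j) Σjump≡ΣT i i<ℓ) (𝟙≤1 (¬? (φ (suc i) ≟ p * φ i)))

    ℓ≤n*jumps : jumps p n ℓ U ≡ weight p n U → ℓ ≤ n * jumps p n ℓ U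
    ℓ≤n*jumps jumps≡weight = subst (λ J → ℓ ≤ n * J) (sym jumps≡Σ<jump)
      (Orbit.ℓ≤n*jumps n ℓ φ C φ-step (carry-bound jumps≡weight) φ-period 0<φ₀)

lemma2p3 : (p : ℕ) → Prime p → p ≢ 2 → (n : ℕ) → 2 ≤ n →
    (ℓ : ℕ) → 1 ≤ ℓ → (U : ℕ → ℕ) →
    IsSolution p n ℓ U → Irreducible p n ℓ U →
    (w r : ℕ) → weight p n U ≡ w → ℓ ≡ n * w + r → 2 * r < w →
    jumps p n ℓ U ≡ w → r ≡ 0
lemma2p3 0 0-prime = contradiction 0-prime ¬prime[0]
lemma2p3 1 1-prime = contradiction 1-prime ¬prime[1]
lemma2p3 (suc (suc k)) _ _ n _ (suc m) _ U (U≤N , N∣W₀ , 0<W₀) _ w r refl ℓ≡nw+r _ jumps≡w =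
  n≤0⇒n≡0 (+-cancelˡ-≤ (n * w) r 0 (begin
    n * w + r   ≡⟨ ℓ≡nw+r ⟨
    suc m       ≤⟨ subst (λ J → suc m ≤ n * J) jumps≡w (Solution.ℓ≤n*jumps k n m U U≤N N∣W₀ 0<W₀ jumps≡w) ⟩
    n * w       ≡⟨ +-identityʳ (n * w) ⟨
    n * w + 0   ∎))
  where open ≤-Reasoning
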